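{- For every $\varepsilon>0$ and every positive integer $t$, there is a finite graph $G$ with $\textit{VR}(G,t)<\varepsilon$.
   Context: The discrete Voronoi game on a finite graph $G$ with $t$ rounds: two players $\mathbf{A}$ and $\mathbf{B}$ alternately claim vertices of $G$, $\mathbf{A}$ first, each player claiming one vertex per round, for $t$ rounds (so $2t$ vertices are claimed; no vertex may be claimed twice; $G$ is assumed to have at least $2t$ vertices). Distances are shortest-path distances in $G$. At the end, each vertex strictly closer to the set of $\mathbf{A}$'s claimed vertices than to the set of $\mathbf{B}$'s claimed vertices belongs to $\mathbf{A}$, each vertex strictly closer to $\mathbf{B}$'s set belongs to $\mathbf{B}$, and each vertex at equal distance is tied (each player receives half of it). The Voronoi ratio $\textit{VR}(G,t)$ is the number of vertices belonging to $\mathbf{A}$ plus half the number of tied vertices, divided by $|V(G)|$, when both players play optimally ($\mathbf{A}$ maximizing this quantity and $\mathbf{B}$ minimizing it). -}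

module Defs where

open import Data.Nat using (ℕ; zero; suc; _+_; _*_; _<ᵇ_; _≡ᵇ_; _⊔_; _⊓_)
open import Data.Bool using (Bool; true; false; not; _∧_; _∨_; if_then_else_; T)
open import Data.Fin using (Fin; _≟_)
open import Data.List using (List; []; _∷_; map; foldr; head; upTo; allFin; filterᵇ)
open import Data.Bool.ListAction using (any)
open import Data.Nat.ListAction using (sum)
open import Data.Maybe using (Maybe; just; nothing)
open import Data.Integer using (+_)
open import Data.Rational using (ℚ; 0ℚ; _/_)
open import Relation.Nullary.Decidable using (⌊_⌋)
open import Relation.Binary.PropositionalEquality using (_≡_)

record Graph : Set where
  field
    n     : ℕ
    adj   : Fin n → Fin n → Bool
    sym   : ∀ u v → adj u v ≡ adj v u
    irrefl : ∀ v → adj v v ≡ false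

module _ (n : ℕ) (adj : Fin n → Fin n → Bool) where

  elem : Fin n → List (Fin n) → Bool
  elem v S = any (λ s → ⌊ v ≟ s ⌋) S

  reach : ℕ → Fin n → List (Fin n) → Bool
  reach zero v S = elem v S
  reach (suc k) v S = reach k v S ∨ any (λ u → adj v u ∧ reach k u S) (allFin n)

  -- shortest-path distance from v to the set S (nothing = ∞, i.e. unreachable
  -- or S empty). Any finite distance is at most n, so searching 0..n suffices.
  dist : Fin n → List (Fin n) → Maybe ℕ
  dist v S = head (filterᵇ (λ k → reach k v S) (upTo (suc n)))

  _<∞_ : Maybe ℕ → Maybe ℕ → Bool
  just a <∞ just b = a <ᵇ b
  just a <∞ nothing = true
  nothing <∞ _ = false

  _=∞_ : Maybe ℕ → Maybe ℕ → Bool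
  just a =∞ just b = a ≡ᵇ b
  nothing =∞ nothing = true
  _ =∞ _ = false

  -- twice the payoff of A: 2 per vertex belonging to A, 1 per tied vertex
  payoff2 : List (Fin n) → List (Fin n) → ℕ
  payoff2 As Bs = sum (map score (allFin n))
    where
    score : Fin n → ℕ
    score v = if dist v As <∞ dist v Bs then 2
              else (if dist v As =∞ dist v Bs then 1 else 0)

  unclaimed : List (Fin n) → List (Fin n) → List (Fin n)
  unclaimed As Bs = filterᵇ (λ v → not (elem v As ∨ elem v Bs)) (allFin n)

  maxList : List ℕ → ℕ
  maxList = foldr _⊔_ 0

  minList : List ℕ → ℕ
  minList [] = 0
  minList (x ∷ xs) = foldr _⊓_ x xs

  -- optimal-play value (doubled payoff) with t rounds remaining,
  -- A to move (valueA) or B to move within the current round (valueB)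
  valueA : ℕ → List (Fin n) → List (Fin n) → ℕ
  valueB : ℕ → List (Fin n) → List (Fin n) → ℕ
  valueA zero As Bs = payoff2 As Bs
  valueA (suc t) As Bs = maxList (map (λ a → valueB t (a ∷ As) Bs) (unclaimed As Bs))
  valueB t As Bs = minList (map (λ b → valueA t As (b ∷ Bs)) (unclaimed As Bs))

VRₙ : (n : ℕ) → (Fin n → Fin n → Bool) → ℕ → ℚ
VRₙ zero adj t = 0ℚ
VRₙ (suc m) adj t = (+ valueA (suc m) adj t [] []) / (2 * suc m)

VR : Graph → ℕ → ℚ
VR G t = VRₙ (Graph.n G) (Graph.adj G) t

-- The graph has k = κ + 1 cores and k hubs; hub j carries N₀ pendant leaves, N₀ being
-- the number of non-leaf vertices, and is joined to core i by a path of length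
-- κ + ((i − j) mod k) + 2.  B answers every move of A by claiming a core: core i, or a
-- vertex on a path to core i, by the cyclic predecessor of core i, which is one step
-- closer to every hub j ≠ i; a hub or a leaf by core 0, which is closer than it to the
-- leaves of every other hub.  Take a leaf of a hub that no move of A touches (each move
-- touches at most two hubs).  A potential that is 1-Lipschitz and vanishes at the leaf
-- shows that B's answer to the vertex of A closest to the leaf is strictly closer still,
-- so B wins the leaf.  Hence A gets at most N₀ (2t + 1) of the N₀ (κ + 2) vertices,
-- which is below ε once κ = (2t + 1) · denominator ε.
module Submission where

open import Defs
open import Data.Bool using (Bool; true; false; not; _∧_; _∨_; if_then_else_; T)
open import Data.Bool.Properties using (∨-comm; T-∨; T-∧)
open import Data.Fin as Fin using (Fin; _≟_; toℕ; fromℕ; fromℕ<; inject₁; splitAt; remQuot; combine; _↑ˡ_; _↑ʳ_)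
open import Data.Fin.Properties using (splitAt-↑ˡ; splitAt-↑ʳ; remQuot-combine; combine-remQuot; join-splitAt; toℕ-fromℕ; toℕ-fromℕ<; toℕ-inject₁; toℕ<n; toℕ-injective)
open import Data.Integer as ℤ using (+[1+_]; -[1+_])
import Data.Integer.Properties as ℤ
open import Data.List using (List; []; _∷_; _++_; map; foldr; head; length; tabulate; upTo; applyUpTo; allFin; filterᵇ; concatMap)
open import Data.List.Extrema.Nat using (argmin; argmin-sel; f[argmin]≤f[xs])
open import Data.List.Membership.Propositional using (_∈_; _∉_; lose; find)
open import Data.List.Membership.Propositional.Properties using (∈-allFin; ∈-filter⁺; ∈-map⁺; ∈-tabulate⁺; ∈-concat⁺′; ∈-++⁺ˡ; ∈-++⁺ʳ)
open import Data.List.Properties using (map-tabulate; length-++; length-tabulate)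
open import Data.List.Relation.Unary.All as All using (All; []; _∷_)
import Data.List.Relation.Unary.All.Properties as All
open import Data.List.Relation.Unary.Any as Any using (Any; here; there)
open import Data.List.Relation.Unary.Any.Properties using (any⁺; any⁻)
open import Data.Maybe using (just; nothing)
open import Data.Nat using (ℕ; zero; suc; _+_; _*_; _∸_; _≤_; _<_; _≤′_; ≤′-refl; ≤′-step; _≤?_; _<ᵇ_; _≡ᵇ_; _⊔_; _⊓_; s≤s⁻¹; z≤n; s≤s)
open import Data.Nat.ListAction using (sum)
open import Data.Nat.Properties hiding (_≟_)
open import Algebra.Properties.CommutativeSemigroup +-commutativeSemigroup using (x∙yz≈y∙xz)
open import Data.Nat.Tactic.RingSolver using (solve-∀)
open import Data.Product using (Σ; ∃-syntax; _×_; _,_; proj₁; proj₂; uncurry)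
open import Data.Rational as ℚ using (ℚ; 0ℚ; _/_; ↧ₙ_; mkℚ; *<*)
open import Data.Rational.Properties using (toℚᵘ-cancel-<; toℚᵘ-fromℚᵘ)
open import Data.Rational.Unnormalised as ℚᵘ using (mkℚᵘ)
import Data.Rational.Unnormalised.Properties as ℚᵘ
open import Data.Sum as Sum using (_⊎_; inj₁; inj₂; [_,_]′)
open import Function using (_∘_; id; Equivalence)
open import Relation.Binary.PropositionalEquality
open import Relation.Nullary using (¬_; yes; no; does; contradiction)
open import Relation.Nullary.Decidable using (⌊_⌋; fromWitness; toWitness; T?)

open Equivalence using (to; from)

T-not-∨ : ∀ {x y} → ¬ T x → ¬ T y → T (not (x ∨ y))
T-not-∨ {true} ¬x _ = ¬x _
T-not-∨ {false} {true} _ ¬y = ¬y _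
T-not-∨ {false} {false} _ _ = _

if-¬T : ∀ {A : Set} x {a b : A} → ¬ T x → (if x then a else b) ≡ b
if-¬T true ¬x = contradiction _ ¬x
if-¬T false _ = refl

head-filterᵇ : ∀ {A : Set} (p : A → Bool) xs {x} → head (filterᵇ p xs) ≡ just x → T (p x)
head-filterᵇ p (y ∷ xs) eq with p y in py
head-filterᵇ p (y ∷ xs) refl | true = subst T (sym py) _
... | false = head-filterᵇ p xs eq

-- f plays the role of λ i → s + i, which cannot be recursed on directly
-- since s + suc i and suc s + i are only propositionally equal.
head-filterᵇ-applyUpTo-≤ : ∀ (p : ℕ → Bool) (f : ℕ → ℕ) s N {K} → (∀ i → f i ≡ s + i) →
  s ≤ K → K < s + N → T (p K) → ∃[ b ] head (filterᵇ p (applyUpTo f N)) ≡ just b × b ≤ K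
head-filterᵇ-applyUpTo-≤ p f s zero f≗s+ s≤K K<s+0 _ =
  contradiction (≤-trans K<s+0 (≤-trans (≤-reflexive (+-identityʳ s)) s≤K)) (<-irrefl refl)
head-filterᵇ-applyUpTo-≤ p f s (suc N) {K} f≗s+ s≤K K<s+N pK with p (f 0) in pf0
... | true = f 0 , refl , ≤-trans (≤-reflexive (trans (f≗s+ 0) (+-identityʳ s))) s≤K
... | false = head-filterᵇ-applyUpTo-≤ p (f ∘ suc) (suc s) N (λ i → trans (f≗s+ (suc i)) (+-suc s i))
                  (≤∧≢⇒< s≤K s≢K) (≤-trans K<s+N (≤-reflexive (+-suc s N))) pK
  where
  s≢K : s ≢ K
  s≢K refl = subst T pf0 (subst (T ∘ p) (sym (trans (f≗s+ 0) (+-identityʳ s))) pK)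

minimiser : ∀ {A : Set} (f : A → ℕ) {x xs} → x ∈ xs → ∃[ a ] a ∈ xs × (∀ {s} → s ∈ xs → f a ≤ f s)
minimiser f {x} {xs} x∈xs = argmin f x xs , argmin∈ (argmin-sel f x xs) ,
                            λ s∈xs → All.lookup (f[argmin]≤f[xs] x xs) s∈xs
  where
  argmin∈ : argmin f x xs ≡ x ⊎ argmin f x xs ∈ xs → argmin f x xs ∈ xs
  argmin∈ (inj₁ eq) = subst (_∈ xs) (sym eq) x∈xs
  argmin∈ (inj₂ m) = m

m∸n≤1+m∸[1+n] : ∀ m n → m ∸ n ≤ suc (m ∸ suc n)
m∸n≤1+m∸[1+n] zero zero = z≤n
m∸n≤1+m∸[1+n] zero (suc n) = z≤n
m∸n≤1+m∸[1+n] (suc m) zero = ≤-refl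
m∸n≤1+m∸[1+n] (suc m) (suc n) = m∸n≤1+m∸[1+n] m n

≟-refl : ∀ {m} (i : Fin m) → (i ≟ i) ≡ yes refl
≟-refl i = ≡-≟-identity _≟_ refl

zeroAt : ∀ {n} → Fin n → (Fin n → ℕ) → Fin n → ℕ
zeroAt x h v = if does (v ≟ x) then 0 else h v

sum-tabulate-zeroAt : ∀ {n} (h : Fin n → ℕ) x → sum (tabulate h) ≡ h x + sum (tabulate (zeroAt x h))
sum-tabulate-zeroAt h Fin.zero = refl
sum-tabulate-zeroAt h (Fin.suc x) = begin
  h Fin.zero + sum (tabulate (h ∘ Fin.suc))
    ≡⟨ cong (h Fin.zero +_) (sum-tabulate-zeroAt (h ∘ Fin.suc) x) ⟩
  h Fin.zero + (h (Fin.suc x) + sum (tabulate (zeroAt x (h ∘ Fin.suc))))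
    ≡⟨ x∙yz≈y∙xz (h Fin.zero) (h (Fin.suc x)) _ ⟩
  h (Fin.suc x) + (h Fin.zero + sum (tabulate (zeroAt x (h ∘ Fin.suc)))) ∎
  where
  open ≡-Reasoning

sum-tabulate-≤-support : ∀ {n} c (h : Fin n → ℕ) (L : List (Fin n)) →
  (∀ v → h v ≤ c) → (∀ v → v ∈ L ⊎ h v ≡ 0) → sum (tabulate h) ≤ c * length L
sum-tabulate-≤-support c h [] _ supp = ≤-reflexive (trans (sum-zero h λ v → vanish (supp v)) (sym (*-zeroʳ c)))
  where
  vanish : ∀ {v} → v ∈ [] ⊎ h v ≡ 0 → h v ≡ 0
  vanish (inj₂ e) = e
  sum-zero : ∀ {n} (h : Fin n → ℕ) → (∀ v → h v ≡ 0) → sum (tabulate h) ≡ 0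
  sum-zero {zero} h _ = refl
  sum-zero {suc n} h h≡0 rewrite h≡0 Fin.zero = sum-zero (h ∘ Fin.suc) (h≡0 ∘ Fin.suc)
sum-tabulate-≤-support c h (x ∷ L) h≤c supp = begin
  sum (tabulate h)                  ≡⟨ sum-tabulate-zeroAt h x ⟩
  h x + sum (tabulate (zeroAt x h)) ≤⟨ +-mono-≤ (h≤c x) (sum-tabulate-≤-support c (zeroAt x h) L h′≤c supp′) ⟩
  c + c * length L                  ≡⟨ *-suc c (length L) ⟨
  c * suc (length L)                ∎
  where
  open ≤-Reasoning
  h′≤c : ∀ v → zeroAt x h v ≤ c
  h′≤c v with v ≟ x
  ... | yes _ = z≤n
  ... | no _ = h≤c v
  supp′ : ∀ v → v ∈ L ⊎ zeroAt x h v ≡ 0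
  supp′ v with v ≟ x | supp v
  ... | yes _ | _ = inj₂ refl
  ... | no v≢x | inj₁ (here v≡x) = contradiction v≡x v≢x
  ... | no _ | inj₁ (there v∈L) = inj₁ v∈L
  ... | no _ | inj₂ hv≡0 = inj₂ hv≡0

length-concatMap-≤ : ∀ {A B : Set} c (f : A → List B) → (∀ x → length (f x) ≤ c) →
  ∀ xs → length (concatMap f xs) ≤ c * length xs
length-concatMap-≤ c f f≤c [] = ≤-reflexive (sym (*-zeroʳ c))
length-concatMap-≤ c f f≤c (x ∷ xs) = begin
  length (f x ++ concatMap f xs)         ≡⟨ length-++ (f x) ⟩
  length (f x) + length (concatMap f xs) ≤⟨ +-mono-≤ (f≤c x) (length-concatMap-≤ c f f≤c xs) ⟩
  c + c * length xs                      ≡⟨ *-suc c (length xs) ⟨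
  c * suc (length xs)                    ∎
  where open ≤-Reasoning

module Game (n : ℕ) (adj : Fin n → Fin n → Bool) where

  open import Data.List.Membership.DecPropositional (_≟_ {n = n}) using (_∈?_)

  elem⇒∈ : ∀ {v S} → T (elem n adj v S) → v ∈ S
  elem⇒∈ {v} {S} t = Any.map toWitness (any⁻ (λ s → ⌊ v ≟ s ⌋) S t)

  ∈⇒elem : ∀ {v S} → v ∈ S → T (elem n adj v S)
  ∈⇒elem v∈S = any⁺ _ (Any.map fromWitness v∈S)

  data Walk (S : List (Fin n)) : ℕ → Fin n → Set where
    arrive : ∀ {k v} → v ∈ S → Walk S k v
    step   : ∀ {k v} u → T (adj v u) → Walk S k u → Walk S (suc k) v

  walk-suc : ∀ {S k v} → Walk S k v → Walk S (suc k) v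
  walk-suc (arrive v∈S) = arrive v∈S
  walk-suc (step u vu w) = step u vu (walk-suc w)

  walk-mono : ∀ {S k k′ v} → k ≤ k′ → Walk S k v → Walk S k′ v
  walk-mono k≤k′ = mono′ (≤⇒≤′ k≤k′)
    where
    mono′ : ∀ {S k k′ v} → k ≤′ k′ → Walk S k v → Walk S k′ v
    mono′ ≤′-refl w = w
    mono′ (≤′-step k≤′k′) w = walk-suc (mono′ k≤′k′ w)

  reach⇒walk : ∀ {S} k {v} → T (reach n adj k v S) → Walk S k v
  reach⇒walk zero r = arrive (elem⇒∈ r)
  reach⇒walk {S} (suc k) {v} r with to T-∨ r
  ... | inj₁ r′ = walk-suc (reach⇒walk k r′)
  ... | inj₂ r′ with find (any⁻ (λ u → adj v u ∧ reach n adj k u S) (allFin n) r′)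
  ...   | u , _ , q with to T-∧ q
  ...     | vu , r″ = step u vu (reach⇒walk k r″)

  walk⇒reach : ∀ {S k v} → Walk S k v → T (reach n adj k v S)
  walk⇒reach {k = zero} (arrive v∈S) = ∈⇒elem v∈S
  walk⇒reach {k = suc k} (arrive v∈S) = from T-∨ (inj₁ (walk⇒reach {k = k} (arrive v∈S)))
  walk⇒reach {S} {suc k} {v} (step u vu w) =
    from T-∨ (inj₂ (any⁺ (λ u → adj v u ∧ reach n adj k u S) (lose (∈-allFin u) (from T-∧ (vu , walk⇒reach w)))))

  walk-potential : (ψ : Fin n → ℕ) → (∀ u w → T (adj u w) → ψ w ≤ suc (ψ u)) →
    ∀ {S k v} → Walk S k v → ∃[ s ] s ∈ S × ψ s ≤ k + ψ v
  walk-potential ψ lip {k = k} {v} (arrive v∈S) = v , v∈S , m≤n+m (ψ v) k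
  walk-potential ψ lip {k = suc k} {v} (step u vu w) =
    let s , s∈S , le = walk-potential ψ lip w in
    s , s∈S , ≤-trans le (≤-trans (+-monoʳ-≤ k (lip v u vu)) (≤-reflexive (+-suc k (ψ v))))

  dist-reach : ∀ {v S a} → dist n adj v S ≡ just a → T (reach n adj a v S)
  dist-reach {v} {S} = head-filterᵇ (λ k → reach n adj k v S) (upTo (suc n))

  dist-≤ : ∀ {K v S} → K ≤ n → Walk S K v → ∃[ b ] dist n adj v S ≡ just b × b ≤ K
  dist-≤ {v = v} {S} K≤n w =
    head-filterᵇ-applyUpTo-≤ (λ k → reach n adj k v S) id 0 (suc n) (λ _ → refl) z≤n (s≤s K≤n) (walk⇒reach w)

  -- The summand of payoff2, which Defs keeps local.
  score : List (Fin n) → List (Fin n) → Fin n → ℕ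
  score As Bs v = if _<∞_ n adj (dist n adj v As) (dist n adj v Bs) then 2
                  else (if _=∞_ n adj (dist n adj v As) (dist n adj v Bs) then 1 else 0)

  payoff2≡sum-score : ∀ As Bs → payoff2 n adj As Bs ≡ sum (tabulate (score As Bs))
  payoff2≡sum-score As Bs = cong sum (map-tabulate id (score As Bs))

  score≤2 : ∀ As Bs v → score As Bs v ≤ 2
  score≤2 As Bs v with _<∞_ n adj (dist n adj v As) (dist n adj v Bs)
  ... | true = ≤-refl
  ... | false with _=∞_ n adj (dist n adj v As) (dist n adj v Bs)
  ...   | true = s≤s z≤n
  ...   | false = z≤n

  score≡0 : ∀ {K As Bs v} → K ≤ n → Walk Bs K v → ¬ Walk As K v → score As Bs v ≡ 0
  score≡0 {K} {As} {Bs} {v} K≤n wB ¬wA with dist-≤ K≤n wB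
  ... | b , dB , b≤K rewrite dB with dist n adj v As in dA
  ...   | nothing = refl
  ...   | just a = trans (if-¬T (a <ᵇ b) (λ a<b → <-asym (<ᵇ⇒< a b a<b) b<a))
                         (if-¬T (a ≡ᵇ b) (λ a≡b → <-irrefl (sym (≡ᵇ⇒≡ a b a≡b)) b<a))
    where
    b<a : b < a
    b<a = ≤-<-trans b≤K (≰⇒> λ a≤K → ¬wA (walk-mono a≤K (reach⇒walk a (dist-reach dA))))

  maxList-≤ : ∀ {c} xs → All (_≤ c) xs → maxList n adj xs ≤ c
  maxList-≤ [] [] = z≤n
  maxList-≤ (_ ∷ xs) (x≤c ∷ xs≤c) = ⊔-lub x≤c (maxList-≤ xs xs≤c)

  minList-≤ : ∀ {c} xs → Any (_≤ c) xs ⊎ xs ≡ [] → minList n adj xs ≤ c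
  minList-≤ [] _ = z≤n
  minList-≤ (x ∷ xs) (inj₁ some≤c) = foldr⊓-≤ xs some≤c
    where
    foldr⊓-≤ : ∀ {c x} xs → Any (_≤ c) (x ∷ xs) → foldr _⊓_ x xs ≤ c
    foldr⊓-≤ [] (here x≤c) = x≤c
    foldr⊓-≤ (y ∷ xs) (here x≤c) = ≤-trans (m⊓n≤n y _) (foldr⊓-≤ xs (here x≤c))
    foldr⊓-≤ (y ∷ xs) (there (here y≤c)) = ≤-trans (m⊓n≤m y _) y≤c
    foldr⊓-≤ (y ∷ xs) (there (there some≤c)) = ≤-trans (m⊓n≤n y _) (foldr⊓-≤ xs (there some≤c))

  unclaimed⁺ : ∀ {v As Bs} → v ∉ As → v ∉ Bs → v ∈ unclaimed n adj As Bs
  unclaimed⁺ {v} v∉As v∉Bs = ∈-filter⁺ (T? ∘ _) (∈-allFin v) (T-not-∨ (v∉As ∘ elem⇒∈) (v∉Bs ∘ elem⇒∈))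

  module Pairing (β : Fin n → Fin n) where

    Answered : List (Fin n) → List (Fin n) → Set
    Answered As Bs = ∀ {a} → a ∈ As → β a ∈ As ⊎ β a ∈ Bs

    extend : ∀ {As Bs a b} → Answered As Bs → β a ∈ a ∷ As ⊎ β a ∈ b ∷ Bs → Answered (a ∷ As) (b ∷ Bs)
    extend _ βa (here refl) = βa
    extend ans _ (there a′∈As) = Sum.map there there (ans a′∈As)

    Answerable : List (Fin n) → List (Fin n) → Fin n → Set
    Answerable As Bs a =
      (∃[ b ] b ∈ unclaimed n adj (a ∷ As) Bs × Answered (a ∷ As) (b ∷ Bs)) ⊎ unclaimed n adj (a ∷ As) Bs ≡ []

    answerable-claimed : ∀ {As Bs a} → Answered As Bs → β a ∈ a ∷ As ⊎ β a ∈ Bs → Answerable As Bs a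
    answerable-claimed {As} {Bs} {a} ans βa with unclaimed n adj (a ∷ As) Bs
    ... | [] = inj₂ refl
    ... | u ∷ _ = inj₁ (u , here refl , extend ans (Sum.map₂ there βa))

    answerable : ∀ {As Bs} → Answered As Bs → ∀ a → Answerable As Bs a
    answerable {As} {Bs} ans a with β a ∈? (a ∷ As) | β a ∈? Bs
    ... | no ∉As | no ∉Bs = inj₁ (β a , unclaimed⁺ ∉As ∉Bs , extend ans (inj₂ (here refl)))
    ... | yes ∈As | _ = answerable-claimed ans (inj₁ ∈As)
    ... | no _ | yes ∈Bs = answerable-claimed ans (inj₂ ∈Bs)

    valueA-≤ : (bound : ℕ → ℕ) →
      (∀ {a As Bs} → Answered (a ∷ As) Bs → payoff2 n adj (a ∷ As) Bs ≤ bound (length (a ∷ As))) →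
      ∀ t {As Bs} → Answered As Bs → 1 ≤ t + length As → valueA n adj t As Bs ≤ bound (t + length As)
    valueA-≤ bound final zero {[]} _ ()
    valueA-≤ bound final zero {_ ∷ _} ans _ = final ans
    valueA-≤ bound final (suc t) {As} {Bs} ans _ =
      maxList-≤ (map (λ a → valueB n adj t (a ∷ As) Bs) (unclaimed n adj As Bs))
                (All.map⁺ (All.tabulate λ {a} _ → valueB-≤ a (answerable ans a)))
      where
      bound′ : ℕ
      bound′ = bound (suc t + length As)
      valueB-≤ : ∀ a → Answerable As Bs a → valueB n adj t (a ∷ As) Bs ≤ bound′
      valueB-≤ a (inj₁ (b , b∈U , ans′)) = minList-≤ _ (inj₁ (lose (∈-map⁺ _ b∈U) IH))
        where
        IH : valueA n adj t (a ∷ As) (b ∷ Bs) ≤ bound′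
        IH = subst (λ m → valueA n adj t (a ∷ As) (b ∷ Bs) ≤ bound m) (+-suc t (length As))
               (valueA-≤ bound final t ans′ (≤-trans (s≤s z≤n) (m≤n+m _ t)))
      valueB-≤ a (inj₂ U≡[]) = minList-≤ _ (inj₂ (cong (map _) U≡[]))

module Construction (κ : ℕ) where

  k : ℕ
  k = suc κ

  -- Λ exceeds every len i j; the path slots q > len i j form a dangling tail at core i.
  Λ : ℕ
  Λ = k + k

  N₀ : ℕ
  N₀ = k + (k + k * (k * Λ))

  Q : ℕ
  Q = N₀

  n : ℕ
  n = N₀ + k * Q

  data Vertex : Set where
    core hub : Fin k → Vertex
    path     : Fin k → Fin k → Fin Λ → Vertex
    leaf     : Fin k → Fin Q → Vertex

  pathAt : Fin k × Fin (k * Λ) → Vertex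
  pathAt (i , w) = uncurry (path i) (remQuot Λ w)

  decodePath : Fin (k * (k * Λ)) → Vertex
  decodePath = pathAt ∘ remQuot (k * Λ)

  decode : Fin n → Vertex
  decode = [ [ core , [ hub , decodePath ]′ ∘ splitAt k ]′ ∘ splitAt k
           , uncurry leaf ∘ remQuot Q ]′ ∘ splitAt N₀

  core↑ : Fin k → Fin n
  core↑ i = (i ↑ˡ (k + k * (k * Λ))) ↑ˡ k * Q

  hub↑ : Fin k → Fin n
  hub↑ j = (k ↑ʳ (j ↑ˡ k * (k * Λ))) ↑ˡ k * Q

  path↑ : Fin k → Fin k → Fin Λ → Fin n
  path↑ i j q = (k ↑ʳ (k ↑ʳ combine i (combine j q))) ↑ˡ k * Q

  leaf↑ : Fin k → Fin Q → Fin n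
  leaf↑ j ℓ = N₀ ↑ʳ combine j ℓ

  decode-core↑ : ∀ i → decode (core↑ i) ≡ core i
  decode-core↑ i rewrite splitAt-↑ˡ N₀ (i ↑ˡ (k + k * (k * Λ))) (k * Q) | splitAt-↑ˡ k i (k + k * (k * Λ)) = refl

  decode-hub↑ : ∀ j → decode (hub↑ j) ≡ hub j
  decode-hub↑ j rewrite splitAt-↑ˡ N₀ (k ↑ʳ (j ↑ˡ k * (k * Λ))) (k * Q)
                      | splitAt-↑ʳ k (k + k * (k * Λ)) (j ↑ˡ k * (k * Λ))
                      | splitAt-↑ˡ k j (k * (k * Λ)) = refl

  decode-path↑ : ∀ i j q → decode (path↑ i j q) ≡ path i j q
  decode-path↑ i j q rewrite splitAt-↑ˡ N₀ (k ↑ʳ (k ↑ʳ combine i (combine j q))) (k * Q)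
                           | splitAt-↑ʳ k (k + k * (k * Λ)) (k ↑ʳ combine i (combine j q))
                           | splitAt-↑ʳ k (k * (k * Λ)) (combine i (combine j q)) =
    trans (cong pathAt (remQuot-combine i (combine j q))) (cong (uncurry (path i)) (remQuot-combine j q))

  decode-leaf↑ : ∀ j ℓ → decode (leaf↑ j ℓ) ≡ leaf j ℓ
  decode-leaf↑ j ℓ rewrite splitAt-↑ʳ N₀ (k * Q) (combine j ℓ) = cong (uncurry leaf) (remQuot-combine j ℓ)

  inner-or-leaf : ∀ v → (∃[ u ] v ≡ u ↑ˡ k * Q) ⊎ (∃[ j ] ∃[ ℓ ] v ≡ leaf↑ j ℓ)
  inner-or-leaf v with splitAt N₀ v in eq
  ... | inj₁ u = inj₁ (u , sym (trans (cong (Fin.join N₀ (k * Q)) (sym eq)) (join-splitAt N₀ (k * Q) v)))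
  ... | inj₂ w = inj₂ (proj₁ (remQuot {k} Q w) , proj₂ (remQuot {k} Q w) ,
                       sym (trans (cong (N₀ ↑ʳ_) (combine-remQuot {k} Q w))
                                  (trans (cong (Fin.join N₀ (k * Q)) (sym eq)) (join-splitAt N₀ (k * Q) v))))

  offsetℕ : ℕ → ℕ → ℕ
  offsetℕ a b with b ≤? a
  ... | yes _ = a ∸ b
  ... | no _ = k + a ∸ b

  offsetℕ≤κ : ∀ {a b} → a ≤ κ → b ≤ κ → offsetℕ a b ≤ κ
  offsetℕ≤κ {a} {b} a≤κ b≤κ with b ≤? a
  ... | yes _ = ≤-trans (m∸n≤m a b) a≤κ
  ... | no b≰a = m≤n+o⇒m∸n≤o (k + a) b (begin
    k + a     ≡⟨ +-suc κ a ⟨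
    κ + suc a ≤⟨ +-monoʳ-≤ κ (≰⇒> b≰a) ⟩
    κ + b     ≡⟨ +-comm κ b ⟩
    b + κ     ∎)
    where open ≤-Reasoning

  predℕ : ℕ → ℕ
  predℕ zero = κ
  predℕ (suc a) = a

  offsetℕ-predℕ : ∀ {a b} → a ≤ κ → b ≤ κ → a ≢ b → suc (offsetℕ (predℕ a) b) ≡ offsetℕ a b
  offsetℕ-predℕ {zero} {zero} _ _ 0≢0 = contradiction refl 0≢0
  offsetℕ-predℕ {zero} {suc b} _ b<κ _ with suc b ≤? κ
  ... | yes _ = trans (sym (+-∸-assoc 1 b<κ)) (cong (_∸ b) (sym (+-identityʳ κ)))
  ... | no b≮κ = contradiction b<κ b≮κ
  offsetℕ-predℕ {suc a} {b} _ b≤κ a+1≢b with b ≤? a | b ≤? suc a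
  ... | yes b≤a | yes _ = sym (+-∸-assoc 1 b≤a)
  ... | yes b≤a | no b≰a+1 = contradiction (m≤n⇒m≤1+n b≤a) b≰a+1
  ... | no b≰a | yes b≤a+1 = contradiction (sym (≤-antisym b≤a+1 (≰⇒> b≰a))) a+1≢b
  ... | no _ | no _ = trans (sym (+-∸-assoc 1 (≤-trans b≤κ (≤-trans (n≤1+n κ) (m≤m+n k a)))))
                             (cong (_∸ b) (sym (+-suc k a)))

  offset : Fin k → Fin k → ℕ
  offset i j = offsetℕ (toℕ i) (toℕ j)

  prev : Fin k → Fin k
  prev Fin.zero = fromℕ κ
  prev (Fin.suc i) = inject₁ i

  toℕ≤κ : ∀ (i : Fin k) → toℕ i ≤ κ
  toℕ≤κ i = s≤s⁻¹ (toℕ<n i)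

  offset≤κ : ∀ i j → offset i j ≤ κ
  offset≤κ i j = offsetℕ≤κ (toℕ≤κ i) (toℕ≤κ j)

  toℕ-prev : ∀ i → toℕ (prev i) ≡ predℕ (toℕ i)
  toℕ-prev Fin.zero = toℕ-fromℕ κ
  toℕ-prev (Fin.suc i) = toℕ-inject₁ i

  offset-prev : ∀ {i j} → i ≢ j → suc (offset (prev i) j) ≡ offset i j
  offset-prev {i} {j} i≢j rewrite toℕ-prev i = offsetℕ-predℕ (toℕ≤κ i) (toℕ≤κ j) (i≢j ∘ toℕ-injective)

  len : Fin k → Fin k → ℕ
  len i j = κ + offset i j

  Edge : Vertex → Vertex → Bool
  Edge (leaf j _) (hub j′) = ⌊ j ≟ j′ ⌋
  Edge (hub j) (path i j′ q) = ⌊ j ≟ j′ ⌋ ∧ (toℕ q ≡ᵇ 0)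
  Edge (path i j q) (path i′ j′ q′) = ⌊ i ≟ i′ ⌋ ∧ (⌊ j ≟ j′ ⌋ ∧ (suc (toℕ q) ≡ᵇ toℕ q′))
  Edge (path i j q) (core i′) = ⌊ i ≟ i′ ⌋ ∧ (toℕ q ≡ᵇ len i j)
  Edge _ _ = false

  Edge-irrefl : ∀ x → Edge x x ≡ false
  Edge-irrefl (core _) = refl
  Edge-irrefl (hub _) = refl
  Edge-irrefl (leaf _ _) = refl
  Edge-irrefl (path i j q) with i ≟ i | j ≟ j
  ... | no _ | _ = refl
  ... | yes _ | no _ = refl
  ... | yes _ | yes _ = suc≢ᵇ (toℕ q)
    where
    suc≢ᵇ : ∀ a → (suc a ≡ᵇ a) ≡ false
    suc≢ᵇ zero = refl
    suc≢ᵇ (suc a) = suc≢ᵇ a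

  adjacent : Vertex → Vertex → Bool
  adjacent x y = Edge x y ∨ Edge y x

  adj : Fin n → Fin n → Bool
  adj u w = adjacent (decode u) (decode w)

  graph : Graph
  graph = record
    { n = n
    ; adj = adj
    ; sym = λ u w → ∨-comm (Edge (decode u) (decode w)) (Edge (decode w) (decode u))
    ; irrefl = λ v → cong (λ b → b ∨ b) (Edge-irrefl (decode v))
    }

  open Game n adj
  open import Data.List.Membership.DecPropositional (_≟_ {n = k}) using (_∈?_)

  -- A claimed vertex can compete only for leaves of the hubs it touches; core i touches
  -- hub i because its predecessor is farther from hub i, not closer.
  touched : Vertex → List (Fin k)
  touched (core i) = i ∷ []
  touched (hub j) = j ∷ []
  touched (path i j _) = i ∷ j ∷ []
  touched (leaf j _) = j ∷ []

  reply : Vertex → Fin k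
  reply (core i) = prev i
  reply (hub _) = Fin.zero
  reply (path i _ _) = prev i
  reply (leaf _ _) = Fin.zero

  -- ψ is 1-Lipschitz and vanishes at leaf ℓ of hub m, hence a lower bound for the distance
  -- to that leaf; it is exact on the cores.
  module Potential (m : Fin k) (ℓ : Fin Q) where

    far : ℕ
    far = 4 + (κ + κ)

    ψhub : Fin k → ℕ
    ψhub j = if ⌊ j ≟ m ⌋ then 1 else far

    ψcore : Fin k → ℕ
    ψcore i = 3 + len i m

    ψ : Vertex → ℕ
    ψ (core i) = ψcore i
    ψ (hub j) = ψhub j
    ψ (path i j q) = (ψhub j + suc (toℕ q)) ⊓ (ψcore i + suc (len i j ∸ toℕ q))
    ψ (leaf j ℓ′) = if ⌊ j ≟ m ⌋ then (if ⌊ ℓ′ ≟ ℓ ⌋ then 0 else 2) else suc (ψhub j)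

    ψcore≤ : ∀ i → ψcore i ≤ 3 + (κ + κ)
    ψcore≤ i = s≤s (s≤s (s≤s (+-monoʳ-≤ κ (offset≤κ i m))))

    ψ-leaf : ψ (leaf m ℓ) ≡ 0
    ψ-leaf with m ≟ m | ℓ ≟ ℓ
    ... | yes _ | yes _ = refl
    ... | no m≢m | _ = contradiction refl m≢m
    ... | yes _ | no ℓ≢ℓ = contradiction refl ℓ≢ℓ

    ψhub-far : ∀ {j} → j ≢ m → ψhub j ≡ far
    ψhub-far {j} j≢m with j ≟ m
    ... | yes j≡m = contradiction j≡m j≢m
    ... | no _ = refl

    ψcore<ψhub : ∀ i {j} → j ≢ m → suc (ψcore i) ≤ ψhub j
    ψcore<ψhub i j≢m rewrite ψhub-far j≢m = s≤s (ψcore≤ i)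

    ψ-Edge : ∀ x y → T (Edge x y) → ψ y ≤ suc (ψ x) × ψ x ≤ suc (ψ y)
    ψ-Edge (leaf j ℓ′) (hub j′) e with j ≟ j′
    ψ-Edge (leaf j ℓ′) (hub j) e | yes refl with j ≟ m
    ... | no _ = ≤-trans (n≤1+n _) (n≤1+n _) , ≤-refl
    ... | yes _ with ℓ′ ≟ ℓ
    ...   | yes _ = s≤s z≤n , z≤n
    ...   | no _ = s≤s z≤n , ≤-refl
    ψ-Edge (hub j) (path i j′ q) e with j ≟ j′
    ψ-Edge (hub j) (path i j q) e | yes refl rewrite ≡ᵇ⇒≡ (toℕ q) 0 e =
      ≤-trans (m⊓n≤m _ _) (≤-reflexive (+-comm (ψhub j) 1)) ,
      ⊓-glb (≤-trans (n≤1+n (ψhub j)) (≤-trans (≤-reflexive (+-comm 1 (ψhub j))) (n≤1+n _))) hub≤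
      where
      hub≤ : ψhub j ≤ suc (ψcore i + suc (len i j))
      hub≤ with j ≟ m
      ... | yes _ = s≤s z≤n
      ... | no _ = s≤s (s≤s (s≤s (s≤s (≤-trans (+-mono-≤ (m≤m+n κ _) (m≤m+n κ _)) (+-monoʳ-≤ (len i m) (n≤1+n _))))))
    ψ-Edge (path i j q) (path i′ j′ q′) e with i ≟ i′ | j ≟ j′
    ψ-Edge (path i j q) (path i j q′) e | yes refl | yes refl rewrite sym (≡ᵇ⇒≡ (suc (toℕ q)) (toℕ q′) e) =
      ⊓-glb (≤-trans (m⊓n≤m _ _) (≤-reflexive (+-suc (ψhub j) (suc (toℕ q)))))
            (≤-trans (m⊓n≤n _ _) (≤-trans (+-monoʳ-≤ (ψcore i) (s≤s (∸-monoʳ-≤ (len i j) (n≤1+n (toℕ q))))) (n≤1+n _))) ,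
      ⊓-glb (≤-trans (m⊓n≤m _ _) (≤-trans (+-monoʳ-≤ (ψhub j) (n≤1+n _)) (n≤1+n _)))
            (≤-trans (m⊓n≤n _ _) (≤-trans (+-monoʳ-≤ (ψcore i) (s≤s (m∸n≤1+m∸[1+n] (len i j) (toℕ q))))
                                          (≤-reflexive (+-suc (ψcore i) _))))
    ψ-Edge (path i j q) (core i′) e with i ≟ i′
    ψ-Edge (path i j q) (core i) e | yes refl rewrite ≡ᵇ⇒≡ (toℕ q) (len i j) e | n∸n≡0 (len i j) =
      ⊓-glb (core≤ j) (≤-trans (n≤1+n _) (≤-trans (≤-reflexive (+-comm 1 (ψcore i))) (n≤1+n _))) ,
      ≤-trans (m⊓n≤n _ _) (≤-reflexive (+-comm (ψcore i) 1))
      where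
      core≤ : ∀ j → ψcore i ≤ suc (ψhub j + suc (len i j))
      core≤ j with j ≟ m
      ... | yes refl = ≤-refl
      ... | no _ = ≤-trans (ψcore≤ i) (≤-trans (n≤1+n _) (≤-trans (m≤m+n far _) (n≤1+n _)))

    ψcore-prev : ∀ {i} → i ≢ m → suc (ψcore (prev i)) ≡ ψcore i
    ψcore-prev i≢m = cong (λ z → 3 + z) (trans (sym (+-suc κ _)) (cong (κ +_) (offset-prev i≢m)))

    reply-closer : ∀ x → m ∉ touched x → suc (ψcore (reply x)) ≤ ψ x
    reply-closer (core i) m∉ = ≤-reflexive (ψcore-prev (m∉ ∘ here ∘ sym))
    reply-closer (hub j) m∉ = ψcore<ψhub Fin.zero (m∉ ∘ here ∘ sym)
    reply-closer (leaf j _) m∉ with j ≟ m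
    ... | yes j≡m = contradiction (here (sym j≡m)) m∉
    ... | no _ = s≤s (≤-trans (ψcore≤ Fin.zero) (n≤1+n _))
    reply-closer (path i j q) m∉ =
      ⊓-glb (≤-trans (ψcore<ψhub (prev i) (m∉ ∘ there ∘ here ∘ sym)) (m≤m+n _ _))
            (≤-trans (≤-reflexive (ψcore-prev (m∉ ∘ here ∘ sym))) (m≤m+n (ψcore i) _))

  edge⇒adj : ∀ u w {x y} → decode u ≡ x → decode w ≡ y → T (Edge x y) → T (adj u w)
  edge⇒adj u w {x} {y} refl refl e = from (T-∨ {Edge x y}) (inj₁ e)

  adj-leaf-hub : ∀ j ℓ → T (adj (leaf↑ j ℓ) (hub↑ j))
  adj-leaf-hub j ℓ = edge⇒adj (leaf↑ j ℓ) (hub↑ j) (decode-leaf↑ j ℓ) (decode-hub↑ j) (fromWitness refl)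

  adj-hub-path : ∀ i j → T (adj (hub↑ j) (path↑ i j Fin.zero))
  adj-hub-path i j = edge⇒adj (hub↑ j) (path↑ i j Fin.zero) (decode-hub↑ j) (decode-path↑ i j Fin.zero) edge
    where
    edge : T (Edge (hub j) (path i j Fin.zero))
    edge rewrite ≟-refl j = _

  adj-path-path : ∀ i j q q′ → toℕ q′ ≡ suc (toℕ q) → T (adj (path↑ i j q) (path↑ i j q′))
  adj-path-path i j q q′ eq = edge⇒adj (path↑ i j q) (path↑ i j q′) (decode-path↑ i j q) (decode-path↑ i j q′) edge
    where
    edge : T (Edge (path i j q) (path i j q′))
    edge rewrite ≟-refl i | ≟-refl j = ≡⇒≡ᵇ _ _ (sym eq)

  adj-path-core : ∀ i j q → toℕ q ≡ len i j → T (adj (path↑ i j q) (core↑ i))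
  adj-path-core i j q eq = edge⇒adj (path↑ i j q) (core↑ i) (decode-path↑ i j q) (decode-core↑ i) edge
    where
    edge : T (Edge (path i j q) (core i))
    edge rewrite ≟-refl i = ≡⇒≡ᵇ _ _ eq

  len<Λ : ∀ i j → len i j < Λ
  len<Λ i j = ≤-trans (s≤s (+-monoʳ-≤ κ (offset≤κ i j))) (≤-trans (n≤1+n _) (≤-reflexive (sym (+-suc k κ))))

  module _ (c m : Fin k) {S : List (Fin n)} (c∈S : core↑ c ∈ S) where

    path-walk : ∀ e {q} → toℕ q + e ≡ len c m → Walk S (suc e) (path↑ c m q)
    path-walk zero {q} eq = step (core↑ c) (adj-path-core c m q (trans (sym (+-identityʳ _)) eq)) (arrive c∈S)
    path-walk (suc e) {q} eq = step (path↑ c m q′) (adj-path-path c m q q′ (toℕ-fromℕ< q+1<Λ)) (path-walk e {q′} eq′)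
      where
      q+1<Λ : suc (toℕ q) < Λ
      q+1<Λ = ≤-<-trans (≤-trans (m≤m+n _ e) (≤-reflexive (trans (sym (+-suc (toℕ q) e)) eq))) (len<Λ c m)
      q′ : Fin Λ
      q′ = fromℕ< q+1<Λ
      eq′ : toℕ q′ + e ≡ len c m
      eq′ = trans (cong (_+ e) (toℕ-fromℕ< q+1<Λ)) (trans (sym (+-suc (toℕ q) e)) eq)

    leaf-walk : ∀ ℓ → Walk S (Potential.ψcore m ℓ c) (leaf↑ m ℓ)
    leaf-walk ℓ = step (hub↑ m) (adj-leaf-hub m ℓ) (step (path↑ c m Fin.zero) (adj-hub-path c m) (path-walk (len c m) {Fin.zero} refl))

  ψcore≤n : ∀ m ℓ c → Potential.ψcore m ℓ c ≤ n
  ψcore≤n m ℓ c = ≤-trans (Potential.ψcore≤ m ℓ c) (≤-trans 3+2κ≤N₀ (m≤m+n N₀ (k * Q)))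
    where
    3+2κ≤N₀ : 3 + (κ + κ) ≤ N₀
    3+2κ≤N₀ = ≤-trans (≤-reflexive (3+2x≡ κ)) (+-monoʳ-≤ k (+-monoʳ-≤ k (s≤s z≤n)))
      where
      3+2x≡ : ∀ x → 3 + (x + x) ≡ suc x + (suc x + 1)
      3+2x≡ = solve-∀

  touchedBy : List (Fin n) → List (Fin k)
  touchedBy = concatMap (touched ∘ decode)

  touchedBy⁺ : ∀ {a As j} → a ∈ As → j ∈ touched (decode a) → j ∈ touchedBy As
  touchedBy⁺ a∈As j∈ = ∈-concat⁺′ j∈ (∈-map⁺ _ a∈As)

  length-touchedBy : ∀ As → length (touchedBy As) ≤ 2 * length As
  length-touchedBy = length-concatMap-≤ 2 (touched ∘ decode) (length-touched ∘ decode)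
    where
    length-touched : ∀ x → length (touched x) ≤ 2
    length-touched (core _) = s≤s z≤n
    length-touched (hub _) = s≤s z≤n
    length-touched (path _ _ _) = ≤-refl
    length-touched (leaf _ _) = s≤s z≤n

  leavesOf : List (Fin k) → List (Fin n)
  leavesOf = concatMap (tabulate ∘ leaf↑)

  inner : List (Fin n)
  inner = tabulate {n = N₀} (_↑ˡ k * Q)

  -- The vertices A can possibly win: all non-leaves and the leaves of touched hubs.
  contested : List (Fin n) → List (Fin n)
  contested As = inner ++ leavesOf (touchedBy As)

  length-contested : ∀ As → length (contested As) ≤ N₀ + Q * (2 * length As)
  length-contested As = begin
    length (contested As)                          ≡⟨ length-++ inner ⟩
    length inner + length (leavesOf (touchedBy As)) ≤⟨ +-mono-≤ (≤-reflexive (length-tabulate {n = N₀} (_↑ˡ k * Q))) leaves≤ ⟩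
    N₀ + Q * (2 * length As)                       ∎
    where
    open ≤-Reasoning
    leaves≤ : length (leavesOf (touchedBy As)) ≤ Q * (2 * length As)
    leaves≤ = ≤-trans (length-concatMap-≤ Q (tabulate ∘ leaf↑) (≤-reflexive ∘ length-tabulate ∘ leaf↑) (touchedBy As))
                      (*-monoʳ-≤ Q (length-touchedBy As))

  β : Fin n → Fin n
  β = core↑ ∘ reply ∘ decode

  open Pairing β

  leaf-lost : ∀ {a As Bs j ℓ} → Answered (a ∷ As) Bs → j ∉ touchedBy (a ∷ As) → score (a ∷ As) Bs (leaf↑ j ℓ) ≡ 0
  leaf-lost {a₀} {As₀} {Bs} {j} {ℓ} ans j∉ = score≡0 (ψcore≤n j ℓ c) (leaf-walk c j core∈Bs ℓ) ¬walkA
    where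
    open Potential j ℓ
    As = a₀ ∷ As₀
    Ψ : Fin n → ℕ
    Ψ = ψ ∘ decode
    Ψ-adj : ∀ u w → T (adj u w) → Ψ w ≤ suc (Ψ u)
    Ψ-adj u w e = [ proj₁ ∘ ψ-Edge (decode u) (decode w) , proj₂ ∘ ψ-Edge (decode w) (decode u) ]′ (to T-∨ e)
    a-min = minimiser Ψ (here refl)
    a = proj₁ a-min
    c = reply (decode a)
    Ψa≤ : ∀ {s} → s ∈ As → Ψ a ≤ Ψ s
    Ψa≤ = proj₂ (proj₂ a-min)
    closer : suc (ψcore c) ≤ Ψ a
    closer = reply-closer (decode a) (j∉ ∘ touchedBy⁺ (proj₁ (proj₂ a-min)))
    core∉As : core↑ c ∉ As
    core∉As c∈As = <-irrefl (sym (cong ψ (decode-core↑ c))) (≤-trans closer (Ψa≤ c∈As))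
    core∈Bs : core↑ c ∈ Bs
    core∈Bs = [ (λ c∈As → contradiction c∈As core∉As) , (λ c∈Bs → c∈Bs) ]′ (ans (proj₁ (proj₂ a-min)))
    ¬walkA : ¬ Walk As (ψcore c) (leaf↑ j ℓ)
    ¬walkA w = let s , s∈As , Ψs≤ = walk-potential Ψ Ψ-adj w in
      <-irrefl refl (≤-trans closer (≤-trans (Ψa≤ s∈As) (≤-trans Ψs≤ (≤-reflexive Ψleaf))))
      where
      Ψleaf : ψcore c + Ψ (leaf↑ j ℓ) ≡ ψcore c
      Ψleaf = trans (cong (λ x → ψcore c + ψ x) (decode-leaf↑ j ℓ)) (trans (cong (ψcore c +_) ψ-leaf) (+-identityʳ _))

  payoff-bound : ∀ {a As Bs} → Answered (a ∷ As) Bs →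
    payoff2 n adj (a ∷ As) Bs ≤ 2 * (N₀ + Q * (2 * length (a ∷ As)))
  payoff-bound {a} {As} {Bs} ans = begin
    payoff2 n adj (a ∷ As) Bs               ≡⟨ payoff2≡sum-score (a ∷ As) Bs ⟩
    sum (tabulate (score (a ∷ As) Bs))      ≤⟨ sum-tabulate-≤-support 2 _ (contested (a ∷ As)) (score≤2 (a ∷ As) Bs) only-contested ⟩
    2 * length (contested (a ∷ As))         ≤⟨ *-monoʳ-≤ 2 (length-contested (a ∷ As)) ⟩
    2 * (N₀ + Q * (2 * length (a ∷ As)))    ∎
    where
    open ≤-Reasoning
    only-contested : ∀ v → v ∈ contested (a ∷ As) ⊎ score (a ∷ As) Bs v ≡ 0
    only-contested v with inner-or-leaf v
    ... | inj₁ (u , refl) = inj₁ (∈-++⁺ˡ (∈-tabulate⁺ {f = _↑ˡ k * Q} u))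
    ... | inj₂ (j , ℓ , refl) with j ∈? touchedBy (a ∷ As)
    ...   | yes j∈ = inj₁ (∈-++⁺ʳ inner (∈-concat⁺′ (∈-tabulate⁺ {f = leaf↑ j} ℓ) (∈-map⁺ (tabulate ∘ leaf↑) j∈)))
    ...   | no j∉ = inj₂ (leaf-lost ans j∉)

  value-bound : ∀ t → 1 ≤ t → valueA n adj t [] [] ≤ 2 * (N₀ + Q * (2 * t))
  value-bound t 1≤t = subst (λ m → valueA n adj t [] [] ≤ 2 * (N₀ + Q * (2 * m))) (+-identityʳ t)
    (valueA-≤ (λ m → 2 * (N₀ + Q * (2 * m))) payoff-bound t (λ ()) (≤-trans 1≤t (m≤m+n t 0)))

/-<-pos : ∀ v N (ε : ℚ) → 0ℚ ℚ.< ε → v * ↧ₙ ε < suc N → (ℤ.+ v) / suc N ℚ.< ε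
/-<-pos v N (mkℚ +[1+ p ] d _) _ lt =
  toℚᵘ-cancel-< (ℚᵘ.<-respˡ-≃ (ℚᵘ.≃-sym (toℚᵘ-fromℚᵘ (mkℚᵘ (ℤ.+ v) N))) (ℚᵘ.*<* cross))
  where
  cross : ℤ.+ v ℤ.* ℤ.+ suc d ℤ.< +[1+ p ] ℤ.* ℤ.+ suc N
  cross = subst₂ ℤ._<_ (ℤ.pos-* v (suc d)) (ℤ.pos-* (suc p) (suc N)) (ℤ.+<+ (≤-trans lt (m≤m+n (suc N) (p * suc N))))
/-<-pos v N (mkℚ (ℤ.+ 0) d _) (*<* (ℤ.+<+ ())) _
/-<-pos v N (mkℚ -[1+ p ] d _) (*<* ()) _

-- The bound of value-bound times D, against twice the number of vertices for κ = D (2t + 1).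
payoff-ratio : ∀ N₀ t D → 1 ≤ N₀ →
  2 * (N₀ + N₀ * (2 * t)) * D < 2 * (N₀ + suc (D * suc (2 * t)) * N₀)
payoff-ratio N₀ t D 1≤N₀ = begin-strict
  2 * (N₀ + N₀ * (2 * t)) * D ≡⟨ expand N₀ t D ⟩
  2 * (κ * N₀)                <⟨ *-monoʳ-< 2 (≤-trans (m<n+m (κ * N₀) 1≤N₀) (m≤n+m _ N₀)) ⟩
  2 * (N₀ + suc κ * N₀)       ∎
  where
  open ≤-Reasoning
  κ = D * suc (2 * t)
  expand : ∀ N t D → 2 * (N + N * (2 * t)) * D ≡ 2 * (D * suc (2 * t) * N)
  expand = solve-∀

theorem1 : (ε : ℚ) → 0ℚ ℚ.< ε → (t : ℕ) → 1 ≤ t →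
    Σ Graph (λ G → (2 * t ≤ Graph.n G) × (VR G t ℚ.< ε))
theorem1 ε 0<ε t 1≤t = graph , 2t≤n , /-<-pos (valueA n adj t [] []) _ ε 0<ε (≤-<-trans value≤ (payoff-ratio N₀ t D (s≤s z≤n)))
  where
  D = ↧ₙ ε
  κ = D * suc (2 * t)
  open Construction κ
  value≤ : valueA n adj t [] [] * D ≤ 2 * (N₀ + N₀ * (2 * t)) * D
  value≤ = *-monoˡ-≤ D (value-bound t 1≤t)
  2t≤n : 2 * t ≤ n
  2t≤n = ≤-trans (≤-trans (n≤1+n _) (m≤n*m (suc (2 * t)) D)) (≤-trans (n≤1+n κ) (≤-trans (m≤m+n k _) (m≤m+n N₀ _)))
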